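{- Let $D$ be a digraph and $I$ an implication class of $D$. Then $I=I^{ -1}$ if and only if $I$ contains a circuit of length $2$.
   Context: A digraph $D=(V,A)$ is finite, without loops or multiple arcs; write $uv\in A$ for an arc. Let $Z_D=\{(x,y): xy\in A\text{ or }yx\in A\}$. For $(x,y),(x',y')\in Z_D$ write $(x,y)\Gamma(x',y')$ if one of the following holds: (i) $x=x'$ and $y=y'$; (ii) $x=x'$, $y\ne y'$, and either ($yx,x'y'\in A$ and $yy'\notin A$) or ($y'x',xy\in A$ and $y'y\notin A$); (iii) $y=y'$, $x\ne x'$, and either ($xy,y'x'\in A$ and $xx'\notin A$) or ($x'y',yx\in A$ and $x'x\notin A$). The equivalence classes of the transitive closure $\Gamma^*$ of $\Gamma$ on $Z_D$ are the implication classes of $D$. For $I\subseteq Z_D$, $I^{ -1}=\{(y,x):(x,y)\in I\}$. A circuit of length $k$ is a set of pairs $(x_1,x_2),\dots,(x_{k-1},x_k),(x_k,x_1)$; a set of pairs contains it if all its pairs belong to the set. (A circuit of length 2 is thus $(x,y),(y,x)$.) -}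

module Defs where

open import Level using (0ℓ)
open import Data.Nat using (ℕ)
open import Data.Fin using (Fin)
open import Data.Product using (_×_; _,_; Σ; ∃)
open import Data.Sum using (_⊎_)
open import Relation.Nullary using (¬_; Dec)
open import Relation.Binary.PropositionalEquality using (_≡_; _≢_)
open import Relation.Binary.Construct.Closure.ReflexiveTransitive using (Star)

-- A finite digraph on vertex set Fin n: an irreflexive arc relation
-- with decidable arc set (A is a finite set), (no loops; "no multiple arcs" is automatic for a relation).
record Digraph : Set₁ where
  field
    n     : ℕ
    Arc   : Fin n → Fin n → Set
    Arc?  : ∀ u v → Dec (Arc u v)
    loopless : ∀ v → ¬ Arc v v

module _ (D : Digraph) where
  open Digraph D

  V : Set
  V = Fin n

  Pair : Set
  Pair = V × V

  InZ : Pair → Set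
  InZ (x , y) = Arc x y ⊎ Arc y x

  data Γ : Pair → Pair → Set where
    Γ-refl : ∀ {x y} → InZ (x , y) → Γ (x , y) (x , y)
    Γ-ii₁  : ∀ {x y y'} → InZ (x , y) → InZ (x , y') → y ≢ y' →
             Arc y x → Arc x y' → ¬ Arc y y' → Γ (x , y) (x , y')
    Γ-ii₂  : ∀ {x y y'} → InZ (x , y) → InZ (x , y') → y ≢ y' →
             Arc y' x → Arc x y → ¬ Arc y' y → Γ (x , y) (x , y')
    Γ-iii₁ : ∀ {x x' y} → InZ (x , y) → InZ (x' , y) → x ≢ x' →
             Arc x y → Arc y x' → ¬ Arc x x' → Γ (x , y) (x' , y)
    Γ-iii₂ : ∀ {x x' y} → InZ (x , y) → InZ (x' , y) → x ≢ x' →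
             Arc x' y → Arc y x → ¬ Arc x' x → Γ (x , y) (x' , y)

  -- transitive closure Γ* (reflexive-transitive closure; Γ is already
  -- reflexive on Z_D, so on Z_D these coincide)
  Γ* : Pair → Pair → Set
  Γ* = Star Γ

  IsImplicationClass : (Pair → Set) → Set
  IsImplicationClass I =
    Σ Pair λ z → InZ z × (∀ p → (I p → Γ* z p) × (Γ* z p → I p))

  Inv : (Pair → Set) → Pair → Set
  Inv I (x , y) = I (y , x)

  SameSet : (Pair → Set) → (Pair → Set) → Set
  SameSet I J = ∀ p → (I p → J p) × (J p → I p)

  ContainsCircuit2 : (Pair → Set) → Set
  ContainsCircuit2 I = Σ V λ x → Σ V λ y → I (x , y) × I (y , x)

-- Γ is symmetric, and swapping both pairs of a Γ-step exchanges clauses (ii) and (iii), so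
-- p Γ* q implies p⁻¹ Γ* q⁻¹. If an implication class I contains (a , b) and (b , a), then every
-- p ∈ I satisfies (a , b) Γ* p, hence (b , a) Γ* p⁻¹, so p⁻¹ ∈ I. Conversely, if I = I⁻¹ then
-- any (x , y) ∈ I gives the circuit (x , y), (y , x).
module Submission where

open import Defs
open import Data.Product using (_×_; _,_; proj₁; proj₂; swap)
open import Data.Sum using (inj₁; inj₂)
open import Relation.Binary.PropositionalEquality using (_≢_; sym)
open import Relation.Binary.Construct.Closure.ReflexiveTransitive
  using (ε; _◅◅_; gmap; reverse)

module _ {D : Digraph} where

  InZ-swap : ∀ {p} → InZ D p → InZ D (swap p)
  InZ-swap (inj₁ xy) = inj₂ xy
  InZ-swap (inj₂ yx) = inj₁ yx

  private
    ≢-sym : ∀ {a b : V D} → a ≢ b → b ≢ a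
    ≢-sym a≢b b≡a = a≢b (sym b≡a)

  Γ-sym : ∀ {p q} → Γ D p q → Γ D q p
  Γ-sym (Γ-refl z)              = Γ-refl z
  Γ-sym (Γ-ii₁ z z′ ne a b c)  = Γ-ii₂ z′ z (≢-sym ne) a b c
  Γ-sym (Γ-ii₂ z z′ ne a b c)  = Γ-ii₁ z′ z (≢-sym ne) a b c
  Γ-sym (Γ-iii₁ z z′ ne a b c) = Γ-iii₂ z′ z (≢-sym ne) a b c
  Γ-sym (Γ-iii₂ z z′ ne a b c) = Γ-iii₁ z′ z (≢-sym ne) a b c

  Γ-swap : ∀ {p q} → Γ D p q → Γ D (swap p) (swap q)
  Γ-swap (Γ-refl z)              = Γ-refl (InZ-swap z)
  Γ-swap (Γ-ii₁ z z′ ne a b c)  = Γ-iii₁ (InZ-swap z) (InZ-swap z′) ne a b c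
  Γ-swap (Γ-ii₂ z z′ ne a b c)  = Γ-iii₂ (InZ-swap z) (InZ-swap z′) ne a b c
  Γ-swap (Γ-iii₁ z z′ ne a b c) = Γ-ii₁ (InZ-swap z) (InZ-swap z′) ne a b c
  Γ-swap (Γ-iii₂ z z′ ne a b c) = Γ-ii₂ (InZ-swap z) (InZ-swap z′) ne a b c

  Γ*-sym : ∀ {p q} → Γ* D p q → Γ* D q p
  Γ*-sym = reverse Γ-sym

  Γ*-swap : ∀ {p q} → Γ* D p q → Γ* D (swap p) (swap q)
  Γ*-swap = gmap swap Γ-swap

  module ImplicationClass {I : Pair D → Set} (isClass : IsImplicationClass D I) where

    representative : Pair D
    representative = proj₁ isClass

    private
      from : ∀ {p} → I p → Γ* D representative p
      from {p} = proj₁ (proj₂ (proj₂ isClass) p)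

      to : ∀ {p} → Γ* D representative p → I p
      to {p} = proj₂ (proj₂ (proj₂ isClass) p)

    nonempty : I representative
    nonempty = to ε

    related : ∀ {p q} → I p → I q → Γ* D p q
    related Ip Iq = Γ*-sym (from Ip) ◅◅ from Iq

    closed : ∀ {p q} → I p → Γ* D p q → I q
    closed Ip p→q = to (from Ip ◅◅ p→q)

    swap-closed : ∀ {p q} → I p → I (swap p) → I q → I (swap q)
    swap-closed Ip Ip⁻¹ Iq = closed Ip⁻¹ (Γ*-swap (related Ip Iq))

mainTheorem11 : (D : Digraph) (I : Pair D → Set) → IsImplicationClass D I →
    (SameSet D I (Inv D I) → ContainsCircuit2 D I) × (ContainsCircuit2 D I → SameSet D I (Inv D I))
mainTheorem11 D I isClass = selfInverse⇒circuit , circuit⇒selfInverse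
  where
    open ImplicationClass isClass

    selfInverse⇒circuit : SameSet D I (Inv D I) → ContainsCircuit2 D I
    selfInverse⇒circuit I≡I⁻¹ =
      proj₁ representative , proj₂ representative , nonempty , proj₁ (I≡I⁻¹ representative) nonempty

    circuit⇒selfInverse : ContainsCircuit2 D I → SameSet D I (Inv D I)
    circuit⇒selfInverse (_ , _ , Ixy , Iyx) _ =
      swap-closed Ixy Iyx , swap-closed Ixy Iyx
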